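{- Let $n \ge 2$ and let $B_n = (k_1+1, k_2+1, \ldots, k_n+1)$ be a bouquet of $n$ circles with a cut-vertex. Then $\dim(L(B_n)) = 2n-1$.
   Context: All graphs are finite, simple, undirected and connected. For integers $k_n \ge k_{n-1} \ge \cdots \ge k_1 \ge 2$, the bouquet $B_n = (k_1+1, \ldots, k_n+1)$ is the graph obtained from $n$ cycles $C^1, \ldots, C^n$, where $C^i$ has $k_i+1$ vertices, by identifying one vertex from each cycle into a single common vertex $v$ (so the cycles pairwise share only $v$). For a graph $H$, a set $W \subseteq V(H)$ is a resolving set if for every pair of distinct vertices $u,w$ there is $x \in W$ with $d(u,x) \ne d(w,x)$ ($d$ the shortest-path distance); $\dim(H)$ is the minimum cardinality of a resolving set. $L(G)$ is the line graph of $G$ (vertices are the edges of $G$, adjacent iff they share an endpoint). -}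

module Defs where

open import Data.Nat using (ℕ; zero; suc; _≤_; _≟_)
open import Data.Fin using (Fin; toℕ)
open import Data.Product using (Σ; ∃; ∃₂; _×_; _,_)
open import Data.Sum using (_⊎_)
open import Data.List using (List; length)
open import Data.List.Relation.Unary.Any using (Any)
open import Relation.Nullary using (¬_; yes; no)
open import Relation.Binary.PropositionalEquality using (_≡_; _≢_)

record Graph : Set₁ where
  field
    Vertex : Set
    Adj    : Vertex → Vertex → Set
open Graph public

record EdgeGraph : Set₁ where
  field
    V    : Set
    E    : Set
    end₁ : E → V
    end₂ : E → V
open EdgeGraph public

IsEnd : (G : EdgeGraph) → V G → E G → Set
IsEnd G x e = (end₁ G e ≡ x) ⊎ (end₂ G e ≡ x)

L : EdgeGraph → Graph
L G = record
  { Vertex = E G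
  ; Adj    = λ e f → (e ≢ f) × (∃ λ x → IsEnd G x e × IsEnd G x f)
  }

data Walk (G : Graph) : Vertex G → Vertex G → ℕ → Set where
  here : ∀ {u} → Walk G u u zero
  step : ∀ {u v w ℓ} → Adj G u v → Walk G v w ℓ → Walk G u w (suc ℓ)

Dist : (G : Graph) → Vertex G → Vertex G → ℕ → Set
Dist G u w m = Walk G u w m × (∀ ℓ → Walk G u w ℓ → m ≤ ℓ)

Resolving : (G : Graph) → List (Vertex G) → Set
Resolving G W = ∀ u w → u ≢ w →
  Any (λ x → ∃₂ λ a b → Dist G u x a × Dist G w x b × a ≢ b) W

MetricDim : (G : Graph) → ℕ → Set
MetricDim G m =
  (Σ (List (Vertex G)) λ W → Resolving G W × length W ≡ m)
  × (∀ W → Resolving G W → m ≤ length W)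

-- Vertices of a bouquet: the common vertex v, and the vertex at position t
-- (1 ≤ t ≤ k i) along cycle i.
data BVertex (n : ℕ) : Set where
  center : BVertex n
  inner  : Fin n → ℕ → BVertex n

-- Bouquet B_n = (k₁+1,…,kₙ+1): cycle i has vertices
-- v = pos 0, pos 1, …, pos (k i), and k i + 1 edges; edge j (0 ≤ j ≤ k i)
-- joins pos j and pos (j+1), where pos (k i + 1) = v.
Bouquet : (n : ℕ) → (Fin n → ℕ) → EdgeGraph
Bouquet n k = record
  { V    = BVertex n
  ; E    = Σ (Fin n) (λ i → Fin (suc (k i)))
  ; end₁ = λ { (i , j) → pos i (toℕ j) }
  ; end₂ = λ { (i , j) → pos i (suc (toℕ j)) }
  }
  where
  pos : Fin n → ℕ → BVertex n
  pos i zero = center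
  pos i (suc t) with suc t ≟ suc (k i)
  ... | yes _ = center
  ... | no  _ = inner i (suc t)

-- In L(Bₙ) the 2n edges at the center form a clique, and the distance from the
-- edge at position p of cycle i, r steps before the last edge of that cycle, to
-- the first (last) edge of cycle t is min(p, r+1) (min(p+1, r)) if i = t and
-- 1 + min(p, r) otherwise. So only edges of cycle t tell the two center edges of
-- cycle t apart, and each such edge sees one of them at distance 1 + min(p, r).
-- Hence a resolving set W meets every cycle, and if two cycles met W only once,
-- suitable center edges of them would be at equal distance from every element of
-- W: |W| ≥ 2n - 1. Conversely, all center edges but one form a resolving set.
module Submission where

open import Defs
open import Data.Nat using (ℕ; _≤_; _*_; _∸_)
open import Data.Fin using (Fin)
import Data.Fin as F

import Data.Nat as ℕ
open import Data.Nat using (zero; suc; _+_; _<_; _⊓_; z≤n; s≤s)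
open import Data.Nat.Properties
open import Data.Fin using (zero; suc; toℕ; fromℕ; fromℕ<)
import Data.Fin.Properties as Fin
open import Data.Vec.Functional using (Vector; replicate; updateAt)
open import Data.Vec.Functional.Properties using (updateAt-updates; updateAt-minimal)
open import Algebra.Properties.CommutativeMonoid.Sum +-0-commutativeMonoid using (sum; sum-replicate-zero)
open import Data.Product using (∃; ∃₂; _×_; _,_; proj₁; proj₂; uncurry)
open import Data.Sum using (_⊎_; inj₁; inj₂)
open import Data.Empty using (⊥; ⊥-elim)
open import Data.List using (List; []; _∷_; length; map; _++_; allFin)
open import Data.List.Properties using (length-map; length-++; length-tabulate)
import Data.List.Relation.Unary.Any as Any
import Data.List.Relation.Unary.Any.Properties as Any
open import Data.List.Relation.Unary.Any using (here; there; any?)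
open import Data.List.Membership.Propositional using (_∈_; find; lose)
open import Data.List.Membership.Propositional.Properties using (∈-map⁺; ∈-++⁺ˡ; ∈-++⁺ʳ; ∈-allFin)
open import Function using (case_of_)
open import Relation.Nullary using (yes; no; ¬?)
open import Relation.Nullary.Decidable using (decidable-stable)
open import Relation.Binary.PropositionalEquality

module _ {G : Graph} where

  Walk-snoc : ∀ {u v w ℓ} → Walk G u v ℓ → Adj G v w → Walk G u w (suc ℓ)
  Walk-snoc here      a = step a here
  Walk-snoc (step b p) a = step b (Walk-snoc p a)

  Walk-⊓ : ∀ {u v a b} → Walk G u v a → Walk G u v b → Walk G u v (a ⊓ b)
  Walk-⊓ {u} {v} {a} {b} p q with ⊓-sel a b
  ... | inj₁ a⊓b≡a = subst (Walk G u v) (sym a⊓b≡a) p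
  ... | inj₂ a⊓b≡b = subst (Walk G u v) (sym a⊓b≡b) q

  Dist-unique : ∀ {u v a b} → Dist G u v a → Dist G u v b → a ≡ b
  Dist-unique (p , a-min) (q , b-min) = ≤-antisym (a-min _ q) (b-min _ p)

  module _ (Adj-sym : ∀ {u v} → Adj G u v → Adj G v u) where

    Walk-reverse : ∀ {u v ℓ} → Walk G u v ℓ → Walk G v u ℓ
    Walk-reverse here       = here
    Walk-reverse (step a p) = Walk-snoc (Walk-reverse p) (Adj-sym a)

    Dist-sym : ∀ {u v m} → Dist G u v m → Dist G v u m
    Dist-sym (p , min) = Walk-reverse p , λ ℓ q → min ℓ (Walk-reverse q)

  module _ {x : Vertex G} (f : Vertex G → ℕ) (f-x : f x ≡ 0)
           (f-adj : ∀ {u v} → Adj G u v → f u ≤ suc (f v)) where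

    potential≤length : ∀ {u ℓ} → Walk G u x ℓ → f u ≤ ℓ
    potential≤length here       = ≤-reflexive f-x
    potential≤length (step a p) = ≤-trans (f-adj a) (s≤s (potential≤length p))

    Dist-potential : ∀ {u} → Walk G u x (f u) → Dist G u x (f u)
    Dist-potential p = p , λ ℓ → potential≤length

L-Adj-sym : ∀ {B : EdgeGraph} {e f} → Adj (L B) e f → Adj (L B) f e
L-Adj-sym (e≢f , x , x∈e , x∈f) = (λ f≡e → e≢f (sym f≡e)) , x , x∈f , x∈e

sum-updateAt-suc : ∀ {n} (v : Vector ℕ n) i → sum (updateAt v i suc) ≡ suc (sum v)
sum-updateAt-suc v zero    = refl
sum-updateAt-suc v (suc i) = trans (cong (v zero +_) (sum-updateAt-suc (λ j → v (suc j)) i))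
                                   (+-suc (v zero) _)

updateAt-suc-≥ : ∀ {n} (v : Vector ℕ n) i j → v j ≤ updateAt v i suc j
updateAt-suc-≥ v i j with j Fin.≟ i
... | yes refl = ≤-trans (m≤n+m (v j) 1) (≤-reflexive (sym (updateAt-updates j v)))
... | no j≢i   = ≤-reflexive (sym (updateAt-minimal j i v j≢i))

module _ {A : Set} {n : ℕ} (class : A → Fin n) where

  histogram : List A → Vector ℕ n
  histogram []       = replicate n 0
  histogram (x ∷ xs) = updateAt (histogram xs) (class x) suc

  length≡sum-histogram : ∀ xs → length xs ≡ sum (histogram xs)
  length≡sum-histogram []       = sym (sum-replicate-zero n)
  length≡sum-histogram (x ∷ xs) =
    trans (cong suc (length≡sum-histogram xs)) (sym (sum-updateAt-suc (histogram xs) (class x)))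

  histogram-∈ : ∀ {x xs} → x ∈ xs → 1 ≤ histogram xs (class x)
  histogram-∈ {x} {_ ∷ xs} (here refl) =
    ≤-trans (s≤s z≤n) (≤-reflexive (sym (updateAt-updates (class x) (histogram xs))))
  histogram-∈ {x} {y ∷ xs} (there x∈xs) =
    ≤-trans (histogram-∈ x∈xs) (updateAt-suc-≥ (histogram xs) (class y) (class x))

  histogram-∷-≥2 : ∀ {x z xs} → x ∈ xs → class x ≡ class z → 2 ≤ histogram (z ∷ xs) (class z)
  histogram-∷-≥2 {x} {z} {xs} x∈xs cx≡cz =
    ≤-trans (s≤s (subst (λ c → 1 ≤ histogram xs c) cx≡cz (histogram-∈ x∈xs)))
            (≤-reflexive (sym (updateAt-updates (class z) (histogram xs))))

  histogram≤1-unique : ∀ {x y xs i} → histogram xs i ≤ 1 →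
                       x ∈ xs → y ∈ xs → class x ≡ i → class y ≡ i → x ≡ y
  histogram≤1-unique _   (here refl) (here refl)  _    _    = refl
  histogram≤1-unique h≤1 (here refl) (there y∈xs) refl cy =
    ⊥-elim (<⇒≱ (histogram-∷-≥2 y∈xs cy) h≤1)
  histogram≤1-unique h≤1 (there x∈xs) (here refl) cx refl =
    ⊥-elim (<⇒≱ (histogram-∷-≥2 x∈xs cx) h≤1)
  histogram≤1-unique {xs = z ∷ xs} {i} h≤1 (there x∈xs) (there y∈xs) cx cy =
    histogram≤1-unique (≤-trans (updateAt-suc-≥ (histogram xs) (class z) i) h≤1) x∈xs y∈xs cx cy

n+n≤sum : ∀ {n} (v : Vector ℕ n) → (∀ i → 2 ≤ v i) → n + n ≤ sum v
n+n≤sum {zero}  v 2≤v = z≤n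
n+n≤sum {suc n} v 2≤v =
  ≤-trans (≤-reflexive (cong suc (+-suc n n)))
          (+-mono-≤ (2≤v zero) (n+n≤sum (λ i → v (suc i)) (λ i → 2≤v (suc i))))

n+n≤1+sum : ∀ {n} (v : Vector ℕ n) → (∀ i → 1 ≤ v i) →
                 (∀ i j → v i ≤ 1 → v j ≤ 1 → i ≡ j) → n + n ≤ suc (sum v)
n+n≤1+sum {zero}  v 1≤v small-unique = z≤n
n+n≤1+sum {suc n} v 1≤v small-unique with v zero ≤? 1
... | yes v₀≤1 =
  ≤-trans (≤-reflexive (cong suc (+-suc n n)))
          (s≤s (+-mono-≤ (1≤v zero) (n+n≤sum (λ i → v (suc i)) others-≥2)))
  where
  others-≥2 : ∀ i → 2 ≤ v (suc i)
  others-≥2 i with v (suc i) ≤? 1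
  ... | yes vᵢ≤1 with () ← small-unique zero (suc i) v₀≤1 vᵢ≤1
  ... | no  vᵢ≰1 = ≰⇒> vᵢ≰1
... | no v₀≰1 =
  ≤-trans (≤-reflexive (cong suc (+-suc n n)))
          (s≤s (≤-trans (s≤s (n+n≤1+sum (λ i → v (suc i)) (λ i → 1≤v (suc i))
                                (λ i j vᵢ≤1 vⱼ≤1 →
                                  Fin.suc-injective (small-unique (suc i) (suc j) vᵢ≤1 vⱼ≤1))))
                        (+-monoˡ-≤ _ (≰⇒> v₀≰1))))

data Side : Set where
  first last : Side

-- Distance from the edge at position p of a cycle, r steps before its last edge,
-- to the first or last edge of that cycle (the two edges of the cycle at the center).
sideDist : Side → ℕ → ℕ → ℕ
sideDist first p r = p ⊓ suc r
sideDist last  p r = suc p ⊓ r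

StepBounded : (ℕ → ℕ → ℕ) → Set
StepBounded f = ∀ p r → f p (suc r) ≤ suc (f (suc p) r) × f (suc p) r ≤ suc (f p (suc r))

shifted-⊓-stepBounded : ∀ a b → StepBounded (λ p r → (a + p) ⊓ (b + r))
shifted-⊓-stepBounded a b p r =
  ⊓-mono-≤ (≤-trans (n≤1+n (a + p)) (≤-trans (≤-reflexive (sym (+-suc a p))) (n≤1+n _)))
           (≤-reflexive (+-suc b r)) ,
  ⊓-mono-≤ (≤-reflexive (+-suc a p))
           (≤-trans (n≤1+n (b + r)) (≤-trans (≤-reflexive (sym (+-suc b r))) (n≤1+n _)))

sideDist-stepBounded : ∀ s → StepBounded (sideDist s)
sideDist-stepBounded first = shifted-⊓-stepBounded 0 1
sideDist-stepBounded last  = shifted-⊓-stepBounded 1 0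

suc-⊓-stepBounded : StepBounded (λ p r → suc (p ⊓ r))
suc-⊓-stepBounded = shifted-⊓-stepBounded 1 1

sideDist≤1 : ∀ s {p r} → p ≡ 0 ⊎ r ≡ 0 → sideDist s p r ≤ 1
sideDist≤1 first {r = r} (inj₁ refl) = z≤n
sideDist≤1 first {p}     (inj₂ refl) = m⊓n≤n p 1
sideDist≤1 last  {r = r} (inj₁ refl) = m⊓n≤m 1 r
sideDist≤1 last  {p}     (inj₂ refl) = z≤n

⊓≡0 : ∀ {p r} → p ≡ 0 ⊎ r ≡ 0 → p ⊓ r ≡ 0
⊓≡0     (inj₁ refl) = refl
⊓≡0 {p} (inj₂ refl) = ⊓-zeroʳ p

sideDist-first≤suc-⊓ : ∀ p r → sideDist first p r ≤ suc (p ⊓ r)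
sideDist-first≤suc-⊓ p r = ⊓-mono-≤ (n≤1+n p) ≤-refl

⊓≡sideDist-first⊓last : ∀ p r → p ⊓ r ≡ sideDist first p r ⊓ sideDist last p r
⊓≡sideDist-first⊓last zero    r       = refl
⊓≡sideDist-first⊓last (suc p) zero    = sym (⊓-zeroʳ (suc p ⊓ 1))
⊓≡sideDist-first⊓last (suc p) (suc r) = cong suc (⊓≡sideDist-first⊓last p r)

⊓-suc-cases : ∀ p r → (p ⊓ suc r ≡ p × p ⊓ r ≡ p) ⊎ (p ⊓ suc r ≡ suc r × p ⊓ r ≡ r)
⊓-suc-cases zero    r       = inj₁ (refl , refl)
⊓-suc-cases (suc p) zero    = inj₂ (cong suc (⊓-zeroʳ p) , refl)
⊓-suc-cases (suc p) (suc r) with ⊓-suc-cases p r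
... | inj₁ (a , b) = inj₁ (cong suc a , cong suc b)
... | inj₂ (a , b) = inj₂ (cong suc a , cong suc b)

sideDist-first-injective : ∀ {p r q s} → sideDist first p r ≡ sideDist first q s →
                           p ⊓ r ≡ q ⊓ s → p + r ≡ q + s → p ≡ q
sideDist-first-injective {p} {r} {q} {s} eq₁ eq₂ eq₃ with ⊓-suc-cases p r | ⊓-suc-cases q s
... | inj₁ (a , _) | inj₁ (a' , _) = trans (sym a) (trans eq₁ a')
... | inj₂ (_ , b) | inj₂ (_ , b') =
  +-cancelʳ-≡ r p q (trans eq₃ (cong (q +_) (trans (sym b') (trans (sym eq₂) b))))
... | inj₁ (a , b) | inj₂ (a' , b') =
  ⊥-elim (1+n≢n (trans (sym a') (trans (sym eq₁) (trans a (trans (sym b) (trans eq₂ b'))))))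
... | inj₂ (a , b) | inj₁ (a' , b') =
  ⊥-elim (1+n≢n (trans (sym a) (trans eq₁ (trans a' (trans (sym b') (trans (sym eq₂) b))))))

sideDist-≢⇒≡1+⊓ : ∀ p r → sideDist first p r ≢ sideDist last p r →
                   ∃ λ s → sideDist s p r ≡ suc (p ⊓ r)
sideDist-≢⇒≡1+⊓ zero    zero    ne = ⊥-elim (ne refl)
sideDist-≢⇒≡1+⊓ zero    (suc r) ne = last , refl
sideDist-≢⇒≡1+⊓ (suc p) zero    ne = first , cong suc (⊓-zeroʳ p)
sideDist-≢⇒≡1+⊓ (suc p) (suc r) ne with sideDist-≢⇒≡1+⊓ p r (λ eq → ne (cong suc eq))
... | first , eq = first , cong suc eq
... | last  , eq = last  , cong suc eq

module BouquetLineGraph (n : ℕ) (k : Fin n → ℕ) (k-pos : ∀ i → 1 ≤ k i) where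

  B : EdgeGraph
  B = Bouquet n k

  G : Graph
  G = L B

  Edge : Set
  Edge = E B

  cycle : Edge → Fin n
  cycle = proj₁

  pos rest : Edge → ℕ
  pos  (i , j) = toℕ j
  rest (i , j) = k i ∸ toℕ j

  pos+rest : ∀ e → pos e + rest e ≡ k (cycle e)
  pos+rest (i , j) = m+[n∸m]≡n (Fin.toℕ≤pred[n] j)

  AtCenter : Edge → Set
  AtCenter e = pos e ≡ 0 ⊎ rest e ≡ 0

  centerPos : ∀ t → Side → Fin (suc (k t))
  centerPos t first = zero
  centerPos t last  = fromℕ (k t)

  centerEdge : Fin n → Side → Edge
  centerEdge t s = t , centerPos t s

  rest-last : ∀ t → rest (centerEdge t last) ≡ 0
  rest-last t = trans (cong (k t ∸_) (Fin.toℕ-fromℕ (k t))) (n∸n≡0 (k t))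

  centerEdge-AtCenter : ∀ t s → AtCenter (centerEdge t s)
  centerEdge-AtCenter t first = inj₁ refl
  centerEdge-AtCenter t last  = inj₂ (rest-last t)

  end₁-center : ∀ i j → end₁ B (i , j) ≡ center → toℕ j ≡ 0
  end₁-center i zero    _ = refl
  end₁-center i (suc j) eq with suc (toℕ j) ℕ.≟ suc (k i)
  ... | yes j+1≡k+1 = ⊥-elim (<⇒≢ (Fin.toℕ<n j) (suc-injective j+1≡k+1))
  end₁-center i (suc j) () | no _

  end₂-center : ∀ i j → end₂ B (i , j) ≡ center → toℕ j ≡ k i
  end₂-center i j eq with suc (toℕ j) ℕ.≟ suc (k i)
  ... | yes j+1≡k+1 = suc-injective j+1≡k+1
  end₂-center i j () | no _

  end₁-inner : ∀ i j {i' m} → end₁ B (i , j) ≡ inner i' m → i ≡ i' × toℕ j ≡ m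
  end₁-inner i zero    ()
  end₁-inner i (suc j) eq with suc (toℕ j) ℕ.≟ suc (k i)
  end₁-inner i (suc j) () | yes _
  end₁-inner i (suc j) refl | no _ = refl , refl

  end₂-inner : ∀ i j {i' m} → end₂ B (i , j) ≡ inner i' m → i ≡ i' × suc (toℕ j) ≡ m
  end₂-inner i j eq with suc (toℕ j) ℕ.≟ suc (k i)
  end₂-inner i j () | yes _
  end₂-inner i j refl | no _ = refl , refl

  end₂-last : ∀ i j → toℕ j ≡ k i → end₂ B (i , j) ≡ center
  end₂-last i j j≡k with suc (toℕ j) ℕ.≟ suc (k i)
  ... | yes _   = refl
  ... | no j≢k  = ⊥-elim (j≢k (cong suc j≡k))

  end₁-suc≡end₂ : ∀ i j j' → toℕ j' ≡ suc (toℕ j) → end₁ B (i , j') ≡ end₂ B (i , j)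
  end₁-suc≡end₂ i j j' eq rewrite eq = refl

  Consecutive : Edge → Edge → Set
  Consecutive e e' = cycle e ≡ cycle e' × suc (pos e) ≡ pos e'

  ≡-by-pos : ∀ {e e'} → cycle e ≡ cycle e' → pos e ≡ pos e' → e ≡ e'
  ≡-by-pos {i , j} refl eq = cong (i ,_) (Fin.toℕ-injective eq)

  center-incident⇒AtCenter : ∀ e → IsEnd B center e → AtCenter e
  center-incident⇒AtCenter (i , j) (inj₁ eq) = inj₁ (end₁-center i j eq)
  center-incident⇒AtCenter (i , j) (inj₂ eq) =
    inj₂ (trans (cong (k i ∸_) (end₂-center i j eq)) (n∸n≡0 (k i)))

  AtCenter⇒center-incident : ∀ e → AtCenter e → IsEnd B center e
  AtCenter⇒center-incident (i , j) (inj₁ j≡0) with Fin.toℕ-injective {j = zero} j≡0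
  ... | refl = inj₁ refl
  AtCenter⇒center-incident (i , j) (inj₂ rest≡0) =
    inj₂ (end₂-last i j (trans (sym (+-identityʳ (toℕ j)))
                              (trans (cong (toℕ j +_) (sym rest≡0)) (pos+rest (i , j)))))

  inner-incident : ∀ e {i' m} → IsEnd B (inner i' m) e →
                   cycle e ≡ i' × (pos e ≡ m ⊎ suc (pos e) ≡ m)
  inner-incident (i , j) (inj₁ eq) with end₁-inner i j eq
  ... | i≡i' , j≡m = i≡i' , inj₁ j≡m
  inner-incident (i , j) (inj₂ eq) with end₂-inner i j eq
  ... | i≡i' , j+1≡m = i≡i' , inj₂ j+1≡m

  Adj-cases : ∀ {e e'} → Adj G e e' →
              (AtCenter e × AtCenter e') ⊎ (Consecutive e e' ⊎ Consecutive e' e)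
  Adj-cases {e} {e'} (_ , center , e∋c , e'∋c) =
    inj₁ (center-incident⇒AtCenter e e∋c , center-incident⇒AtCenter e' e'∋c)
  Adj-cases {e} {e'} (e≢e' , inner i m , e∋v , e'∋v)
    with inner-incident e e∋v | inner-incident e' e'∋v
  ... | refl , inj₁ a | refl , inj₁ b = ⊥-elim (e≢e' (≡-by-pos refl (trans a (sym b))))
  ... | refl , inj₁ a | refl , inj₂ b = inj₂ (inj₂ (refl , trans b (sym a)))
  ... | refl , inj₂ a | refl , inj₁ b = inj₂ (inj₁ (refl , trans a (sym b)))
  ... | refl , inj₂ a | refl , inj₂ b = ⊥-elim (e≢e' (≡-by-pos refl (suc-injective (trans a (sym b)))))

  AtCenter-Adj : ∀ {e e'} → AtCenter e → AtCenter e' → e ≢ e' → Adj G e e'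
  AtCenter-Adj {e} {e'} c c' e≢e' =
    e≢e' , center , AtCenter⇒center-incident e c , AtCenter⇒center-incident e' c'

  Consecutive-Adj : ∀ {e e'} → Consecutive e e' → Adj G e e'
  Consecutive-Adj {i , j} {.i , j'} (refl , eq) =
    (λ e≡e' → 1+n≢n (trans eq (sym (cong pos e≡e')))) ,
    end₂ B (i , j) , inj₂ refl , inj₁ (end₁-suc≡end₂ i j j' (sym eq))

  rest-Consecutive : ∀ {e e'} → Consecutive e e' → rest e ≡ suc (rest e')
  rest-Consecutive {e} {e'} (refl , pos≡) = +-cancelˡ-≡ (pos e) _ _ (begin
    pos e + rest e         ≡⟨ pos+rest e ⟩
    k (cycle e)            ≡⟨ sym (pos+rest e') ⟩
    pos e' + rest e'       ≡⟨ cong (_+ rest e') (sym pos≡) ⟩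
    suc (pos e + rest e')  ≡⟨ sym (+-suc (pos e) (rest e')) ⟩
    pos e + suc (rest e')  ∎)
    where open ≡-Reasoning

  Adj-sym : ∀ {e e'} → Adj G e e' → Adj G e' e
  Adj-sym = L-Adj-sym {B}

  first≢last : ∀ t → centerEdge t first ≢ centerEdge t last
  first≢last t eq = <⇒≢ (k-pos t) (trans (cong pos eq) (Fin.toℕ-fromℕ (k t)))

  walk-along : ∀ i d (j j' : Fin (suc (k i))) → toℕ j ≡ d + toℕ j' → Walk G (i , j) (i , j') d
  walk-along i zero    j j' eq = subst (λ x → Walk G (i , j) (i , x) 0) (Fin.toℕ-injective eq) here
  walk-along i (suc d) j j' eq =
    step (Adj-sym (Consecutive-Adj (refl , trans (cong suc (Fin.toℕ-fromℕ< below)) (sym eq))))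
         (walk-along i d (fromℕ< below) j' (Fin.toℕ-fromℕ< below))
    where
    below : d + toℕ j' < suc (k i)
    below = m≤n⇒m≤1+n (≤-trans (≤-reflexive (sym eq)) (Fin.toℕ≤pred[n] j))

  walk-to-first : ∀ e → Walk G e (centerEdge (cycle e) first) (pos e)
  walk-to-first (i , j) = walk-along i (toℕ j) j zero (sym (+-identityʳ (toℕ j)))

  walk-to-last : ∀ e → Walk G e (centerEdge (cycle e) last) (rest e)
  walk-to-last (i , j) = Walk-reverse Adj-sym (walk-along i (k i ∸ toℕ j) (fromℕ (k i)) j
    (trans (Fin.toℕ-fromℕ (k i)) (sym (m∸n+n≡m (Fin.toℕ≤pred[n] j)))))

  centerDist : Edge → ℕ
  centerDist e = pos e ⊓ rest e

  profile : Fin n → Side → Fin n → ℕ → ℕ → ℕ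
  profile t s i with i Fin.≟ t
  ... | yes _ = sideDist s
  ... | no  _ = λ p r → suc (p ⊓ r)

  landmarkDist : Fin n → Side → Edge → ℕ
  landmarkDist t s e = profile t s (cycle e) (pos e) (rest e)

  landmarkDist-same : ∀ t s e → cycle e ≡ t → landmarkDist t s e ≡ sideDist s (pos e) (rest e)
  landmarkDist-same t s e eq with cycle e Fin.≟ t
  ... | yes _   = refl
  ... | no  i≢t = ⊥-elim (i≢t eq)

  landmarkDist-other : ∀ t s e → cycle e ≢ t → landmarkDist t s e ≡ suc (centerDist e)
  landmarkDist-other t s e i≢t with cycle e Fin.≟ t
  ... | yes eq = ⊥-elim (i≢t eq)
  ... | no  _  = refl

  profile-stepBounded : ∀ t s i → StepBounded (profile t s i)
  profile-stepBounded t s i with i Fin.≟ t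
  ... | yes _ = sideDist-stepBounded s
  ... | no  _ = suc-⊓-stepBounded

  landmarkDist-centerEdge : ∀ t s → landmarkDist t s (centerEdge t s) ≡ 0
  landmarkDist-centerEdge t first = landmarkDist-same t first (centerEdge t first) refl
  landmarkDist-centerEdge t last  = trans (landmarkDist-same t last (centerEdge t last) refl)
                                          (cong (sideDist last (toℕ (fromℕ (k t)))) (rest-last t))

  landmarkDist-AtCenter : ∀ t s e → AtCenter e → landmarkDist t s e ≤ 1
  landmarkDist-AtCenter t s e c with cycle e Fin.≟ t
  ... | yes _ = sideDist≤1 s c
  ... | no  _ = s≤s (≤-reflexive (⊓≡0 c))

  landmarkDist-Consecutive : ∀ t s {e e'} → Consecutive e e' →
    landmarkDist t s e ≤ suc (landmarkDist t s e') × landmarkDist t s e' ≤ suc (landmarkDist t s e)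
  landmarkDist-Consecutive t s {e} c@(refl , pos≡) = shift (sym pos≡) (rest-Consecutive c)
    where
    shift : ∀ {p r p' r'} → p' ≡ suc p → r ≡ suc r' →
           let f = profile t s (cycle e) in f p r ≤ suc (f p' r') × f p' r' ≤ suc (f p r)
    shift refl refl = profile-stepBounded t s (cycle e) _ _

  landmarkDist-Adj : ∀ t s {e e'} → Adj G e e' → landmarkDist t s e ≤ suc (landmarkDist t s e')
  landmarkDist-Adj t s {e} a with Adj-cases a
  ... | inj₁ (c , _)  = ≤-trans (landmarkDist-AtCenter t s e c) (s≤s z≤n)
  ... | inj₂ (inj₁ c) = proj₁ (landmarkDist-Consecutive t s c)
  ... | inj₂ (inj₂ c) = proj₂ (landmarkDist-Consecutive t s c)

  first-Adj-last : ∀ t → Adj G (centerEdge t first) (centerEdge t last)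
  first-Adj-last t = AtCenter-Adj (centerEdge-AtCenter t first) (centerEdge-AtCenter t last) (first≢last t)

  landmarkDist-walk : ∀ t s e → Walk G e (centerEdge t s) (landmarkDist t s e)
  landmarkDist-walk t s e with cycle e Fin.≟ t
  landmarkDist-walk t first e | yes refl =
    Walk-⊓ (walk-to-first e) (Walk-snoc (walk-to-last e) (Adj-sym (first-Adj-last t)))
  landmarkDist-walk t last  e | yes refl =
    Walk-⊓ (Walk-snoc (walk-to-first e) (first-Adj-last t)) (walk-to-last e)
  ... | no i≢t = Walk-⊓ (Walk-snoc (walk-to-first e) (cross first)) (Walk-snoc (walk-to-last e) (cross last))
    where
    cross : ∀ s' → Adj G (centerEdge (cycle e) s') (centerEdge t s)
    cross s' = AtCenter-Adj (centerEdge-AtCenter _ s') (centerEdge-AtCenter t s) (λ eq → i≢t (cong cycle eq))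

  Dist-landmark : ∀ t s e → Dist G e (centerEdge t s) (landmarkDist t s e)
  Dist-landmark t s e = Dist-potential (landmarkDist t s) (landmarkDist-centerEdge t s)
                                       (landmarkDist-Adj t s) (landmarkDist-walk t s e)

  Dist-from-landmark : ∀ {t s e d} → Dist G (centerEdge t s) e d → d ≡ landmarkDist t s e
  Dist-from-landmark D = Dist-unique (Dist-sym Adj-sym D) (Dist-landmark _ _ _)

  Distinguishes : Edge → Edge → Edge → Set
  Distinguishes u w x = ∃₂ λ a b → Dist G u x a × Dist G w x b × a ≢ b

  Distinguishes-centerEdges : ∀ {t s t' s' x} →
    Distinguishes (centerEdge t s) (centerEdge t' s') x → landmarkDist t s x ≢ landmarkDist t' s' x
  Distinguishes-centerEdges (a , b , Da , Db , a≢b) eq =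
    a≢b (trans (Dist-from-landmark Da) (trans eq (sym (Dist-from-landmark Db))))

  Distinguishes-first-last⇒cycle≡ : ∀ {t x} →
    Distinguishes (centerEdge t first) (centerEdge t last) x → cycle x ≡ t
  Distinguishes-first-last⇒cycle≡ {t} {x} dist with cycle x Fin.≟ t
  ... | yes x∈t = x∈t
  ... | no  x∉t = ⊥-elim (Distinguishes-centerEdges dist
        (trans (landmarkDist-other t first x x∉t) (sym (landmarkDist-other t last x x∉t))))

  -- x sees centerEdge t s as if the latter lay on another cycle.
  Blind : Fin n → Side → Edge → Set
  Blind t s x = landmarkDist t s x ≡ suc (centerDist x)

  module LowerBound (W : List Edge) (W-resolving : Resolving G W) where

    count : Vector ℕ n
    count = histogram cycle W

    blind-witness : ∀ i → ∃ λ y → y ∈ W × cycle y ≡ i × ∃ λ s → Blind i s y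
    blind-witness i with find (W-resolving (centerEdge i first) (centerEdge i last) (first≢last i))
    ... | y , y∈W , dist with Distinguishes-first-last⇒cycle≡ dist
    ... | y∈i with sideDist-≢⇒≡1+⊓ (pos y) (rest y) (λ eq → Distinguishes-centerEdges dist
                     (trans (landmarkDist-same i first y y∈i) (trans eq (sym (landmarkDist-same i last y y∈i)))))
    ... | s , s-blind = y , y∈W , y∈i , s , trans (landmarkDist-same i s y y∈i) s-blind

    1≤count : ∀ i → 1 ≤ count i
    1≤count i with blind-witness i
    ... | y , y∈W , refl , _ = histogram-∈ cycle y∈W

    blind-everywhere : ∀ {i s y} → count i ≤ 1 → y ∈ W → cycle y ≡ i → Blind i s y →
                       ∀ {z} → z ∈ W → Blind i s z
    blind-everywhere {i} {s} count≤1 y∈W y∈i y-blind {z} z∈W = case cycle z Fin.≟ i of λ where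
      (yes z∈i) → subst (Blind i s) (histogram≤1-unique cycle count≤1 y∈W z∈W y∈i z∈i) y-blind
      (no  z∉i) → landmarkDist-other i s z z∉i

    count≤1-unique : ∀ i i' → count i ≤ 1 → count i' ≤ 1 → i ≡ i'
    count≤1-unique i i' c≤1 c'≤1 with i Fin.≟ i'
    ... | yes i≡i' = i≡i'
    ... | no i≢i' with blind-witness i | blind-witness i'
    ... | y , y∈W , y∈i , s , y-blind | y' , y'∈W , y'∈i' , s' , y'-blind
      with find (W-resolving (centerEdge i s) (centerEdge i' s') (λ eq → i≢i' (cong cycle eq)))
    ... | z , z∈W , dist = ⊥-elim (Distinguishes-centerEdges dist
          (trans (blind-everywhere c≤1 y∈W y∈i y-blind z∈W)
                 (sym (blind-everywhere c'≤1 y'∈W y'∈i' y'-blind z∈W))))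

    lower-bound : 2 * n ∸ 1 ≤ length W
    lower-bound = ∸-monoˡ-≤ 1 (begin
      2 * n                  ≡⟨ cong (n +_) (+-identityʳ n) ⟩
      n + n                  ≤⟨ n+n≤1+sum count 1≤count count≤1-unique ⟩
      suc (sum count)        ≡⟨ cong suc (sym (length≡sum-histogram cycle W)) ⟩
      suc (length W)         ∎)
      where open ≤-Reasoning

module UpperBound (m : ℕ) (k : Fin (suc (suc m)) → ℕ) (k-pos : ∀ i → 1 ≤ k i) where
  open BouquetLineGraph (suc (suc m)) k k-pos

  onNonzeroCycles : Side → List (Fin (suc (suc m)) × Side)
  onNonzeroCycles s = map (λ l → suc l , s) (allFin (suc m))

  landmarkSides : List (Fin (suc (suc m)) × Side)
  landmarkSides = (zero , first) ∷ onNonzeroCycles first ++ onNonzeroCycles last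

  landmarks : List Edge
  landmarks = map (uncurry centerEdge) landmarkSides

  length-onNonzeroCycles : ∀ s → length (onNonzeroCycles s) ≡ suc m
  length-onNonzeroCycles s = trans (length-map _ (allFin (suc m))) (length-tabulate (λ l → l))

  length-landmarks : length landmarks ≡ 2 * suc (suc m) ∸ 1
  length-landmarks = begin
    length landmarks                                   ≡⟨ length-map (uncurry centerEdge) landmarkSides ⟩
    suc (length (onNonzeroCycles first ++ onNonzeroCycles last))
                                                       ≡⟨ cong suc (length-++ (onNonzeroCycles first)) ⟩
    suc (length (onNonzeroCycles first) + length (onNonzeroCycles last))
                                                       ≡⟨ cong₂ (λ a b → suc (a + b)) (length-onNonzeroCycles first)
                                                                                     (length-onNonzeroCycles last) ⟩
    suc (suc m + suc m)                                ≡⟨ cong (λ a → suc (suc m + a)) (sym (+-identityʳ (suc m))) ⟩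
    suc (suc m + (suc m + 0))                          ≡⟨ sym (+-suc (suc m) (suc m + 0)) ⟩
    2 * suc (suc m) ∸ 1                                ∎
    where open ≡-Reasoning

  first∈ : ∀ t → (t , first) ∈ landmarkSides
  first∈ zero    = here refl
  first∈ (suc l) = there (∈-++⁺ˡ (∈-map⁺ (λ l → suc l , first) (∈-allFin l)))

  last∈ : ∀ l → (suc l , last) ∈ landmarkSides
  last∈ l = there (∈-++⁺ʳ (onNonzeroCycles first) (∈-map⁺ (λ l → suc l , last) (∈-allFin l)))

  AgreeOnLandmarks : Edge → Edge → Set
  AgreeOnLandmarks u w = ∀ {t s} → (t , s) ∈ landmarkSides → landmarkDist t s u ≡ landmarkDist t s w

  another : Fin (suc (suc m)) → Fin (suc (suc m))
  another zero    = suc zero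
  another (suc _) = zero

  another≢ : ∀ i → i ≢ another i
  another≢ zero    ()
  another≢ (suc i) ()

  agree-same-cycle : ∀ {u w} → AgreeOnLandmarks u w → cycle u ≡ cycle w → u ≡ w
  agree-same-cycle {u} {w} agree refl = ≡-by-pos refl (sideDist-first-injective
    (trans (sym (landmarkDist-same i first u refl)) (trans (agree (first∈ i)) (landmarkDist-same i first w refl)))
    (suc-injective (trans (sym (landmarkDist-other i' first u (another≢ i)))
                          (trans (agree (first∈ i')) (landmarkDist-other i' first w (another≢ i)))))
    (trans (pos+rest u) (sym (pos+rest w))))
    where
    i i' : Fin (suc (suc m))
    i  = cycle u
    i' = another i

  agree-centerDist : ∀ {u w} l → AgreeOnLandmarks u w → cycle u ≡ suc l → cycle w ≢ suc l →
                     centerDist u ≡ suc (centerDist w)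
  agree-centerDist {u} {w} l agree u∈l w∉l = begin
    centerDist u                                                   ≡⟨ ⊓≡sideDist-first⊓last (pos u) (rest u) ⟩
    sideDist first (pos u) (rest u) ⊓ sideDist last (pos u) (rest u) ≡⟨ cong₂ _⊓_ (far first) (far last) ⟩
    suc (centerDist w) ⊓ suc (centerDist w)                        ≡⟨ ⊓-idem _ ⟩
    suc (centerDist w)                                             ∎
    where
    open ≡-Reasoning
    sides∈ : ∀ s → (suc l , s) ∈ landmarkSides
    sides∈ first = first∈ (suc l)
    sides∈ last  = last∈ l
    far : ∀ s → sideDist s (pos u) (rest u) ≡ suc (centerDist w)
    far s = trans (sym (landmarkDist-same (suc l) s u u∈l))
                  (trans (agree (sides∈ s)) (landmarkDist-other (suc l) s w w∉l))

  agree-other-cycles : ∀ {u w} l → AgreeOnLandmarks u w → cycle u ≢ cycle w → cycle w ≡ suc l → ⊥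
  agree-other-cycles {u} {w} l agree u≢w w∈l = case-on-cycle (cycle u) refl
    where
    w-further : centerDist w ≡ suc (centerDist u)
    w-further = agree-centerDist l (λ ts∈ → sym (agree ts∈)) w∈l
                                   (λ u∈l → u≢w (trans u∈l (sym w∈l)))
    case-on-cycle : ∀ i → cycle u ≡ i → ⊥
    case-on-cycle zero u∈0 = <⇒≱ (n<1+n (suc (centerDist u))) (begin
      suc (suc (centerDist u))         ≡⟨ cong suc (sym w-further) ⟩
      suc (centerDist w)               ≡⟨ sym (landmarkDist-other zero first w w∉0) ⟩
      landmarkDist zero first w       ≡⟨ sym (agree (first∈ zero)) ⟩
      landmarkDist zero first u       ≡⟨ landmarkDist-same zero first u u∈0 ⟩
      sideDist first (pos u) (rest u) ≤⟨ sideDist-first≤suc-⊓ (pos u) (rest u) ⟩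
      suc (centerDist u)               ∎)
      where
      open ≤-Reasoning
      w∉0 : cycle w ≢ zero
      w∉0 w∈0 = Fin.0≢1+n (trans (sym w∈0) w∈l)
    case-on-cycle (suc l') u∈l' = m≢1+n+m (centerDist u) {1} (trans
      (agree-centerDist l' agree u∈l' (λ w∈l' → u≢w (trans u∈l' (sym w∈l'))))
      (cong suc w-further))

  agree⇒≡ : ∀ {u w} → AgreeOnLandmarks u w → u ≡ w
  agree⇒≡ {u} {w} agree with cycle u Fin.≟ cycle w
  ... | yes same = agree-same-cycle agree same
  ... | no differ = by-cycles (cycle u) (cycle w) refl refl
    where
    by-cycles : ∀ i i' → cycle u ≡ i → cycle w ≡ i' → u ≡ w
    by-cycles _       (suc l) _  w∈ = ⊥-elim (agree-other-cycles l agree differ w∈)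
    by-cycles (suc l) zero    u∈ _  =
      ⊥-elim (agree-other-cycles l (λ ts∈ → sym (agree ts∈)) (λ eq → differ (sym eq)) u∈)
    by-cycles zero    zero    u∈ w∈ = ⊥-elim (differ (trans u∈ (sym w∈)))

  resolving : Resolving G landmarks
  resolving u w u≢w with any? (λ (t , s) → ¬? (landmarkDist t s u ℕ.≟ landmarkDist t s w)) landmarkSides
  ... | yes differs =
    Any.map⁺ (Any.map (λ {(t , s)} d → _ , _ , Dist-landmark t s u , Dist-landmark t s w , d) differs)
  ... | no agrees =
    ⊥-elim (u≢w (agree⇒≡ λ ts∈ → decidable-stable (_ ℕ.≟ _) λ d → agrees (lose ts∈ d)))

theorem2p13 : (n : ℕ) → 2 ≤ n → (k : Fin n → ℕ) →
    (∀ i → 2 ≤ k i) → (∀ i j → i F.≤ j → k i ≤ k j) →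
    MetricDim (L (Bouquet n k)) (2 * n ∸ 1)
theorem2p13 (suc (suc m)) (s≤s (s≤s z≤n)) k 2≤k _ =
  (landmarks , resolving , length-landmarks) ,
  λ W W-resolving → BouquetLineGraph.LowerBound.lower-bound n k k-pos W W-resolving
  where
  n = suc (suc m)
  k-pos : ∀ i → 1 ≤ k i
  k-pos i = <⇒≤ (2≤k i)
  open UpperBound m k k-pos
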